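{- Let $t\ge 1$ and $N\ge 3$ be integers and $S_{1^t}$ the star with $t$ leaves. Then $\mathcal{G}_{I_N}(S_{1^t})=2$ if $t\le N-1$ and $t$ is odd; $=3$ if $t\le N-1$ and $t$ is even; $=0$ if $t=N+i$ with $i\ge 0$ even; $=1$ if $t=N+i$ with $i$ odd.
   Context: $I_N=\{1,\ldots,N\}$. For a set $L$ of positive integers, the game $CSG(L)$ on a connected graph $G$ is the two-player impartial game in which a move consists in removing from the current graph a connected subgraph $H$ such that $|V(H)|\in L$ and the remaining graph is connected (the empty graph counts as connected, so removing the whole graph is allowed when its size is in $L$). The player unable to move loses. $\mathcal{G}_L(G)$ is the Grundy value of $CSG(L)$ on $G$. -}

module Defs where

open import Data.Bool using (Bool; true; false; _∧_; _∨_; not; if_then_else_)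
open import Data.Nat using (ℕ; zero; suc; _≤ᵇ_; _≡ᵇ_)
open import Data.Fin using (Fin; zero; suc)
open import Data.Vec using (Vec; []; _∷_; lookup; tabulate)
open import Data.List as List using (List; []; _∷_; map; filterᵇ; _++_)
open import Data.Bool.ListAction using (any)
open import Data.Maybe using (Maybe; just; nothing)
open import Data.Fin.Subset using (Subset; ∣_∣; _─_; ⊤; ⁅_⁆)
open import Relation.Binary.PropositionalEquality using (_≡_; refl)

record Graph (n : ℕ) : Set where
  field
    adj     : Fin n → Fin n → Bool
    adj-sym : ∀ i j → adj i j ≡ adj j i
    adj-irr : ∀ i → adj i i ≡ false
open Graph public

anyFin : {n : ℕ} → (Fin n → Bool) → Bool
anyFin {zero}  f = false
anyFin {suc n} f = f zero ∨ anyFin (λ i → f (suc i))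

allFin : {n : ℕ} → (Fin n → Bool) → Bool
allFin {zero}  f = true
allFin {suc n} f = f zero ∧ allFin (λ i → f (suc i))

_⊆ᵇ_ : {n : ℕ} → Subset n → Subset n → Bool
S ⊆ᵇ R = allFin (λ v → not (lookup S v) ∨ lookup R v)

minElem : {n : ℕ} → Subset n → Maybe (Fin n)
minElem []          = nothing
minElem (true  ∷ S) = just zero
minElem (false ∷ S) with minElem S
... | just v  = just (suc v)
... | nothing = nothing

subsets : (n : ℕ) → List (Subset n)
subsets zero    = [] ∷ []
subsets (suc n) = map (false ∷_) (subsets n) ++ map (true ∷_) (subsets n)

reachStep : {n : ℕ} → Graph n → Subset n → Subset n → Subset n
reachStep G S R =
  tabulate λ v → lookup S v ∧ (lookup R v ∨ anyFin (λ u → lookup R u ∧ adj G u v))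

iter : {A : Set} → ℕ → (A → A) → A → A
iter zero    f x = x
iter (suc k) f x = f (iter k f x)

-- G[S] is connected: S is empty (the empty graph counts as connected),
-- or every vertex of S is reachable inside G[S] from the least vertex v
-- of S (paths of length ≤ n suffice).
connected : {n : ℕ} → Graph n → Subset n → Bool
connected {n} G S with minElem S
... | nothing = true
... | just v  = S ⊆ᵇ iter n (reachStep G S) ⁅ v ⁆

-- A position is the vertex set P of the current graph G[P].

isMove : {n : ℕ} → Graph n → (ℕ → Bool) → Subset n → Subset n → Bool
isMove G L P U = (U ⊆ᵇ P) ∧ L ∣ U ∣ ∧ connected G U ∧ connected G (P ─ U)

options : {n : ℕ} → Graph n → (ℕ → Bool) → Subset n → List (Subset n)
options {n} G L P = map (λ U → P ─ U) (filterᵇ (isMove G L P) (subsets n))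

_∈ᵇ_ : ℕ → List ℕ → Bool
k ∈ᵇ xs = any (λ x → k ≡ᵇ x) xs

mexFrom : ℕ → ℕ → List ℕ → ℕ
mexFrom zero    k xs = k
mexFrom (suc f) k xs = if k ∈ᵇ xs then mexFrom f (suc k) xs else k

mex : List ℕ → ℕ
mex xs = mexFrom (suc (List.length xs)) 0 xs

-- Grundy value with fuel; since every L considered consists of positive
-- integers, every move removes ≥ 1 vertex, so fuel n + 1 is enough.
grundyF : {n : ℕ} → ℕ → Graph n → (ℕ → Bool) → Subset n → ℕ
grundyF zero    G L P = 0
grundyF (suc f) G L P = mex (map (grundyF f G L) (options G L P))

𝒢 : {n : ℕ} → (ℕ → Bool) → Graph n → ℕ
𝒢 {n} L G = grundyF (suc n) G L ⊤

I : ℕ → (ℕ → Bool)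
I N k = (1 ≤ᵇ k) ∧ (k ≤ᵇ N)

-- The star S_{1^t}: centre zero, leaves suc i for i : Fin t.
starAdj : {t : ℕ} → Fin (suc t) → Fin (suc t) → Bool
starAdj zero    zero    = false
starAdj zero    (suc _) = true
starAdj (suc _) zero    = true
starAdj (suc _) (suc _) = false

starAdj-sym : {t : ℕ} → (i j : Fin (suc t)) → starAdj i j ≡ starAdj j i
starAdj-sym zero    zero    = refl
starAdj-sym zero    (suc _) = refl
starAdj-sym (suc _) zero    = refl
starAdj-sym (suc _) (suc _) = refl

starAdj-irr : {t : ℕ} → (i : Fin (suc t)) → starAdj i i ≡ false
starAdj-irr zero    = refl
starAdj-irr (suc _) = refl

star : (t : ℕ) → Graph (suc t)
star t = record { adj = starAdj ; adj-sym = starAdj-sym ; adj-irr = starAdj-irr }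

-- Positions of CSG(I_N) on the star are the centre with K leaves or at most one leaf, since
-- two leaves are never adjacent.  From the centre with K leaves one can prune a leaf
-- (reaching K - 1), remove everything when K < N (value 0), or remove the centre with all
-- but one leaf when 1 ≤ K ≤ N (value 1).  Hence g(0) = 1 and
-- g(K) = mex {g(K - 1), 0 if K < N, 1 if 1 ≤ K ≤ N}, which alternates 2, 3 for K < N,
-- is 0 at K = N because g(N - 1) ≠ 0, and then alternates 1, 0.
module Submission where

open import Defs
open import Data.Bool using (Bool; true; false; _∧_; _∨_; not; T)
open import Data.Bool.Properties using (T-≡; T-∧; T-∨)
open import Data.Fin using (Fin; zero; suc)
open import Data.Fin.Properties using () renaming (_≟_ to _≟ᶠ_)
open import Data.Fin.Subset
  using (Subset; inside; outside; ∣_∣; _─_; _-_; ⁅_⁆; _∈_; _⊆_; Empty; Nonempty)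
open import Data.Fin.Subset.Properties
  using (x∈⁅x⁆; x∈⁅y⁆⇒x≡y; ∣⁅x⁆∣≡1; p⊆q⇒∣p∣≤∣q∣; drop-∷-⊆; Empty-unique; ∣⊥∣≡0;
         nonempty?; ∣⊤∣≡n; x∈p∧x≢y⇒x∈p-y; p─q⊆p; out⊆; s⊆s)
open import Data.Maybe using (just; nothing)
open import Data.Nat using (ℕ; zero; suc; _+_; _∸_; _≤_; _<_; z≤n; s≤s; _≟_; _≡ᵇ_)
open import Data.Nat.Divisibility using (_∣_; _∣0; ∣-refl; ∣1⇒≡1; ∣m+n∣m⇒∣n; ∣m∣n⇒∣m+n)
open import Data.Nat.Properties
  using (+-comm; +-suc; +-identityʳ; +-cancelʳ-≡; suc-injective; ≤-refl; ≤-trans; ≤-antisym;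
         ≤-pred; n≤1+n; m<n⇒m<1+n; <⇒≤; <⇒≢; ≮⇒≥; n≮n; m+n≮m; m+1+n≰m; m<m+n; n<1⇒n≡0;
         m<n⇒n≢0; 0≢1+n; 1+n≢0; m<1+n⇒m<n∨m≡n; m≤n⇒m<n∨m≡n; ≤⇒≤ᵇ; ≤ᵇ⇒≤; ≡ᵇ⇒≡; ≡⇒≡ᵇ)
open import Data.Product using (_×_; _,_; proj₁; proj₂; ∃-syntax)
open import Data.Sum using (_⊎_; inj₁; inj₂)
open import Data.Unit using (tt)
open import Data.Vec using ([]; _∷_; lookup; tabulate)
open Data.Vec._[_]=_ using (here; there)
open import Data.Vec.Properties using (lookup∘tabulate; []=⇒lookup; lookup⇒[]=)
open import Data.List using (List; []; _∷_; length; map)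
open import Data.List.Properties using (filter-notAll)
open import Data.List.Membership.Propositional using () renaming (_∈_ to _∈ₗ_; _∉_ to _∉ₗ_)
open import Data.List.Membership.Propositional.Properties
  using (∈-map⁺; ∈-map⁻; ∈-++⁺ˡ; ∈-++⁺ʳ; ∈-filter⁺; ∈-filter⁻)
open import Data.List.Relation.Unary.Any as Any using (here; there)
open import Function.Base using (_∘_; id)
open import Function.Bundles using (_⇔_; mk⇔; Equivalence)
open import Relation.Nullary using (¬_; ¬?; yes; no; contradiction; T?)
open import Relation.Binary.PropositionalEquality
  using (_≡_; _≢_; refl; sym; trans; cong; subst; module ≡-Reasoning)

open Equivalence using (to; from)

private
  variable
    n : ℕ

-- Boolean reflection

T-anyFin⁺ : ∀ {f : Fin n → Bool} i → T (f i) → T (anyFin f)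
T-anyFin⁺         zero    fi = from T-∨ (inj₁ fi)
T-anyFin⁺ {f = f} (suc i) fi = from (T-∨ {f zero}) (inj₂ (T-anyFin⁺ i fi))

T-anyFin⁻ : ∀ {f : Fin n → Bool} → T (anyFin f) → ∃[ i ] T (f i)
T-anyFin⁻ {suc n} {f} some with to (T-∨ {f zero}) some
... | inj₁ f0 = zero , f0
... | inj₂ rest with T-anyFin⁻ rest
...   | i , fi = suc i , fi

T-allFin⁺ : ∀ {f : Fin n → Bool} → (∀ i → T (f i)) → T (allFin f)
T-allFin⁺ {zero}  all = tt
T-allFin⁺ {suc n} all = from T-∧ (all zero , T-allFin⁺ (λ i → all (suc i)))

T-allFin⁻ : ∀ {f : Fin n → Bool} → T (allFin f) → ∀ i → T (f i)
T-allFin⁻ {suc n} {f} all zero    = to (T-∧ {f zero}) all .proj₁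
T-allFin⁻ {suc n} {f} all (suc i) = T-allFin⁻ (to (T-∧ {f zero}) all .proj₂) i

∈⇔T-lookup : ∀ {x : Fin n} {p} → x ∈ p ⇔ T (lookup p x)
∈⇔T-lookup {x = x} {p} = mk⇔ (λ x∈p → from T-≡ ([]=⇒lookup x∈p)) (λ t → lookup⇒[]= x p (to T-≡ t))

T-not∨⇔→ : ∀ {a b} → T (not a ∨ b) ⇔ (T a → T b)
T-not∨⇔→ {true}  = mk⇔ (λ b _ → b) (λ f → f tt)
T-not∨⇔→ {false} = mk⇔ (λ _ ()) (λ _ → tt)

T-⊆ᵇ⁺ : ∀ {S R : Subset n} → S ⊆ R → T (S ⊆ᵇ R)
T-⊆ᵇ⁺ {S = S} {R} S⊆R = T-allFin⁺ λ v → from (T-not∨⇔→ {lookup S v}) λ v∈S →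
  to ∈⇔T-lookup (S⊆R (from ∈⇔T-lookup v∈S))

T-⊆ᵇ⁻ : ∀ {S R : Subset n} → T (S ⊆ᵇ R) → S ⊆ R
T-⊆ᵇ⁻ S⊆ᵇR {v} v∈S =
  from ∈⇔T-lookup (to T-not∨⇔→ (T-allFin⁻ S⊆ᵇR v) (to ∈⇔T-lookup v∈S))

-- Cardinalities of subsets

∣p─q∣+∣q∣≡∣p∣ : ∀ {p q : Subset n} → q ⊆ p → ∣ p ─ q ∣ + ∣ q ∣ ≡ ∣ p ∣
∣p─q∣+∣q∣≡∣p∣ {p = []}          {[]}          _   = refl
∣p─q∣+∣q∣≡∣p∣ {p = outside ∷ p} {inside  ∷ q} q⊆p = contradiction (q⊆p here) λ ()
∣p─q∣+∣q∣≡∣p∣ {p = inside  ∷ p} {inside  ∷ q} q⊆p =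
  trans (+-suc ∣ p ─ q ∣ ∣ q ∣) (cong suc (∣p─q∣+∣q∣≡∣p∣ (drop-∷-⊆ q⊆p)))
∣p─q∣+∣q∣≡∣p∣ {p = inside  ∷ p} {outside ∷ q} q⊆p = cong suc (∣p─q∣+∣q∣≡∣p∣ (drop-∷-⊆ q⊆p))
∣p─q∣+∣q∣≡∣p∣ {p = outside ∷ p} {outside ∷ q} q⊆p = ∣p─q∣+∣q∣≡∣p∣ (drop-∷-⊆ q⊆p)

∣p─p∣≡0 : (p : Subset n) → ∣ p ─ p ∣ ≡ 0
∣p─p∣≡0 p = +-cancelʳ-≡ ∣ p ∣ ∣ p ─ p ∣ 0 (∣p─q∣+∣q∣≡∣p∣ {p = p} (λ x∈p → x∈p))

⁅x⁆⊆p : ∀ {x : Fin n} {p} → x ∈ p → ⁅ x ⁆ ⊆ p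
⁅x⁆⊆p x∈p y∈⁅x⁆ = subst (_∈ _) (sym (x∈⁅y⁆⇒x≡y _ y∈⁅x⁆)) x∈p

x∈p⇒1+∣p-x∣≡∣p∣ : ∀ {x : Fin n} {p} → x ∈ p → suc ∣ p - x ∣ ≡ ∣ p ∣
x∈p⇒1+∣p-x∣≡∣p∣ {x = x} {p} x∈p = begin
  suc ∣ p - x ∣          ≡⟨ +-comm 1 ∣ p - x ∣ ⟩
  ∣ p - x ∣ + 1          ≡⟨ cong (∣ p - x ∣ +_) (sym (∣⁅x⁆∣≡1 x)) ⟩
  ∣ p - x ∣ + ∣ ⁅ x ⁆ ∣  ≡⟨ ∣p─q∣+∣q∣≡∣p∣ (⁅x⁆⊆p x∈p) ⟩
  ∣ p ∣                  ∎
  where open ≡-Reasoning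

∣p─[p-x]∣≡1 : ∀ {x : Fin n} {p} → x ∈ p → ∣ p ─ (p - x) ∣ ≡ 1
∣p─[p-x]∣≡1 {x = x} {p} x∈p = +-cancelʳ-≡ ∣ p - x ∣ ∣ p ─ (p - x) ∣ 1
  (trans (∣p─q∣+∣q∣≡∣p∣ {p = p} (p─q⊆p p ⁅ x ⁆)) (sym (x∈p⇒1+∣p-x∣≡∣p∣ x∈p)))

x∈p⇒1≤∣p∣ : ∀ {x : Fin n} {p} → x ∈ p → 1 ≤ ∣ p ∣
x∈p⇒1≤∣p∣ x∈p = subst (1 ≤_) (x∈p⇒1+∣p-x∣≡∣p∣ x∈p) (s≤s z≤n)

∣p∣≡1+k⇒Nonempty : ∀ {p : Subset n} {k} → ∣ p ∣ ≡ suc k → Nonempty p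
∣p∣≡1+k⇒Nonempty {n} {p} ∣p∣≡1+k with nonempty? p
... | yes ne = ne
... | no empty with () ← trans (sym ∣p∣≡1+k) (trans (cong ∣_∣ (Empty-unique empty)) (∣⊥∣≡0 n))

∣p∣≤1⇒≡ : ∀ {p : Subset n} {x y} → ∣ p ∣ ≤ 1 → x ∈ p → y ∈ p → y ≡ x
∣p∣≤1⇒≡ {p = p} {x} {y} ∣p∣≤1 x∈p y∈p with y ≟ᶠ x
... | yes y≡x = y≡x
... | no  y≢x with () ← ≤-trans (x∈p⇒1≤∣p∣ (x∈p∧x≢y⇒x∈p-y y∈p y≢x))
                                (≤-pred (subst (_≤ 1) (sym (x∈p⇒1+∣p-x∣≡∣p∣ x∈p)) ∣p∣≤1))

-- Connectivity

minElem-just : ∀ {S : Subset n} {v} → minElem S ≡ just v → v ∈ S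
minElem-just {S = inside  ∷ S} refl = here
minElem-just {S = outside ∷ S} eq with minElem S in eq′
minElem-just {S = outside ∷ S} refl | just w = there (minElem-just eq′)

minElem-nothing : ∀ {S : Subset n} → minElem S ≡ nothing → Empty S
minElem-nothing {S = inside  ∷ S} ()
minElem-nothing {S = outside ∷ S} eq (suc x , there x∈S) with minElem S in eq′
... | nothing = minElem-nothing eq′ (x , x∈S)

module _ (G : Graph n) where

  Reaches : Subset n → Fin n → Set
  Reaches R v = ∃[ u ] u ∈ R × T (adj G u v)

  ∈-reachStep⁺ : ∀ {S R v} → v ∈ S → v ∈ R ⊎ Reaches R v → v ∈ reachStep G S R
  ∈-reachStep⁺ {S} {R} {v} v∈S v∈R⊎reached = from ∈⇔T-lookup
    (subst T (sym (lookup∘tabulate _ v))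
      (from T-∧ (to ∈⇔T-lookup v∈S , from T-∨ (reach v∈R⊎reached))))
    where
    reach : v ∈ R ⊎ Reaches R v → T (lookup R v) ⊎ T (anyFin λ u → lookup R u ∧ adj G u v)
    reach (inj₁ v∈R)             = inj₁ (to ∈⇔T-lookup v∈R)
    reach (inj₂ (u , u∈R , u~v)) = inj₂ (T-anyFin⁺ u (from T-∧ (to ∈⇔T-lookup u∈R , u~v)))

  ∈-reachStep⁻ : ∀ {S R v} → v ∈ reachStep G S R → v ∈ S × (v ∈ R ⊎ Reaches R v)
  ∈-reachStep⁻ {S} {R} {v} v∈step
    with to T-∧ (subst T (lookup∘tabulate _ v) (to ∈⇔T-lookup v∈step))
  ... | v∈S , reached = from ∈⇔T-lookup v∈S , reach (to T-∨ reached)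
    where
    reach : T (lookup R v) ⊎ T (anyFin λ u → lookup R u ∧ adj G u v) → v ∈ R ⊎ Reaches R v
    reach (inj₁ v∈R) = inj₁ (from ∈⇔T-lookup v∈R)
    reach (inj₂ some) with T-anyFin⁻ some
    ... | u , u∈R∧u~v with to T-∧ u∈R∧u~v
    ...   | u∈R , u~v = inj₂ (u , from ∈⇔T-lookup u∈R , u~v)

  root∈reach : ∀ {S r} → r ∈ S → ∀ k → r ∈ iter k (reachStep G S) ⁅ r ⁆
  root∈reach {r = r} r∈S zero    = x∈⁅x⁆ r
  root∈reach         r∈S (suc k) = ∈-reachStep⁺ r∈S (inj₁ (root∈reach r∈S k))

  reach⊆closed : ∀ {S R Q} → (∀ {u v} → u ∈ Q → T (adj G u v) → v ∈ S → v ∈ Q) →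
                 R ⊆ Q → ∀ k → iter k (reachStep G S) R ⊆ Q
  reach⊆closed closed R⊆Q zero    v∈R = R⊆Q v∈R
  reach⊆closed closed R⊆Q (suc k) v∈step with ∈-reachStep⁻ v∈step
  ... | v∈S , inj₁ v∈R             = reach⊆closed closed R⊆Q k v∈R
  ... | v∈S , inj₂ (u , u∈R , u~v) = closed (reach⊆closed closed R⊆Q k u∈R) u~v v∈S

  connected⁺ : ∀ {S} → (∀ {r} → minElem S ≡ just r → S ⊆ iter n (reachStep G S) ⁅ r ⁆) →
               T (connected G S)
  connected⁺ {S} spans with minElem S
  ... | nothing = tt
  ... | just r  = T-⊆ᵇ⁺ (spans refl)

  connected⁻ : ∀ {S} → T (connected G S) →
               Empty S ⊎ ∃[ r ] r ∈ S × S ⊆ iter n (reachStep G S) ⁅ r ⁆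
  connected⁻ {S} conn with minElem S in eq
  ... | nothing = inj₁ (minElem-nothing eq)
  ... | just r  = inj₂ (r , minElem-just eq , T-⊆ᵇ⁻ conn)

  ∣S∣≤1⇒connected : ∀ {S} → ∣ S ∣ ≤ 1 → T (connected G S)
  ∣S∣≤1⇒connected {S} ∣S∣≤1 = connected⁺ {S} λ {r} eq v∈S →
    subst (λ v → v ∈ iter n (reachStep G S) ⁅ r ⁆)
          (sym (∣p∣≤1⇒≡ {p = S} ∣S∣≤1 (minElem-just eq) v∈S))
          (root∈reach (minElem-just {S = S} eq) n)

module _ {t : ℕ} where

  star-connected-centre : (B : Subset t) → T (connected (star t) (inside ∷ B))
  star-connected-centre B = connected⁺ (star t) spans
    where
    S = inside ∷ B
    spans : ∀ {r} → minElem S ≡ just r → S ⊆ iter (suc t) (reachStep (star t) S) ⁅ r ⁆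
    centre∈S : zero ∈ S
    centre∈S = here
    spans refl {zero}  here         = root∈reach (star t) centre∈S (suc t)
    spans refl {suc v} v∈S@(there _) =
      ∈-reachStep⁺ (star t) v∈S (inj₂ (zero , root∈reach (star t) centre∈S t , tt))

  star-leaves-independent : ∀ {C : Subset t} {u v} →
                            u ∈ outside ∷ C → v ∈ outside ∷ C → ¬ T (adj (star t) u v)
  star-leaves-independent (there _) (there _) ()

  star-connected-leaves⇒∣∣≤1 : ∀ {C : Subset t} →
                               T (connected (star t) (outside ∷ C)) → ∣ C ∣ ≤ 1
  star-connected-leaves⇒∣∣≤1 {C} conn with connected⁻ (star t) conn
  ... | inj₁ empty =
    subst (_≤ 1) (sym (trans (cong ∣_∣ (Empty-unique empty)) (∣⊥∣≡0 (suc t)))) z≤n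
  ... | inj₂ (r , r∈S , S⊆reach) = subst (∣ C ∣ ≤_) (∣⁅x⁆∣≡1 r)
    (p⊆q⇒∣p∣≤∣q∣ (reach⊆closed (star t) closed id (suc t) ∘ S⊆reach))
    where
    closed : ∀ {u v} → u ∈ ⁅ r ⁆ → T (adj (star t) u v) → v ∈ outside ∷ C → v ∈ ⁅ r ⁆
    closed u∈⁅r⁆ u~v v∈S = contradiction u~v
      (star-leaves-independent (subst (_∈ _) (sym (x∈⁅y⁆⇒x≡y r u∈⁅r⁆)) r∈S) v∈S)

-- Moves and Grundy values

record Move (G : Graph n) (L : ℕ → Bool) (P U : Subset n) : Set where
  field
    removed⊆position : U ⊆ P
    size∈L           : T (L ∣ U ∣)
    removedConnected : T (connected G U)
    restConnected    : T (connected G (P ─ U))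
open Move

module _ {G : Graph n} {L : ℕ → Bool} {P U : Subset n} where

  Move⇒isMove : Move G L P U → T (isMove G L P U)
  Move⇒isMove m = from T-∧ (T-⊆ᵇ⁺ (removed⊆position m) ,
                   from T-∧ (size∈L m , from T-∧ (removedConnected m , restConnected m)))

  isMove⇒Move : T (isMove G L P U) → Move G L P U
  isMove⇒Move move with to T-∧ move
  ... | U⊆ᵇP , rest with to T-∧ rest
  ...   | inL , rest′ with to T-∧ rest′
  ...     | connU , connRest = record
    { removed⊆position = T-⊆ᵇ⁻ U⊆ᵇP
    ; size∈L           = inL
    ; removedConnected = connU
    ; restConnected    = connRest
    }

∈-subsets : (U : Subset n) → U ∈ₗ subsets n
∈-subsets []                  = here refl
∈-subsets {suc n} (outside ∷ U) = ∈-++⁺ˡ (∈-map⁺ (outside ∷_) (∈-subsets U))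
∈-subsets {suc n} (inside  ∷ U) = ∈-++⁺ʳ _ (∈-map⁺ (inside ∷_) (∈-subsets U))

module _ {G : Graph n} {L : ℕ → Bool} {P : Subset n} where

  ∈-options⁺ : ∀ {U} → Move G L P U → P ─ U ∈ₗ options G L P
  ∈-options⁺ {U} m = ∈-map⁺ (P ─_) (∈-filter⁺ (T? ∘ isMove G L P) (∈-subsets U) (Move⇒isMove m))

  ∈-options⁻ : ∀ {Q} → Q ∈ₗ options G L P → ∃[ U ] Move G L P U × Q ≡ P ─ U
  ∈-options⁻ Q∈ with ∈-map⁻ (P ─_) Q∈
  ... | U , U∈ , refl =
    U , isMove⇒Move (∈-filter⁻ (T? ∘ isMove G L P) {xs = subsets n} U∈ .proj₂) , refl

T-∈ᵇ⇔∈ : ∀ {k} {xs : List ℕ} → T (k ∈ᵇ xs) ⇔ k ∈ₗ xs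
T-∈ᵇ⇔∈ {k} {[]}     = mk⇔ (λ ()) (λ ())
T-∈ᵇ⇔∈ {k} {x ∷ xs} = mk⇔ forward backward
  where
  forward : T (k ∈ᵇ (x ∷ xs)) → k ∈ₗ x ∷ xs
  forward k∈ with to (T-∨ {k ≡ᵇ x}) k∈
  ... | inj₁ k≡x  = here (≡ᵇ⇒≡ k x k≡x)
  ... | inj₂ k∈xs = there (to T-∈ᵇ⇔∈ k∈xs)
  backward : k ∈ₗ x ∷ xs → T (k ∈ᵇ (x ∷ xs))
  backward (here k≡x)  = from T-∨ (inj₁ (≡⇒≡ᵇ k x k≡x))
  backward (there k∈xs) = from (T-∨ {k ≡ᵇ x}) (inj₂ (from T-∈ᵇ⇔∈ k∈xs))

-- Pigeonhole: deleting m-1 from xs leaves 0, …, m-2 in a strictly shorter list.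
initialSegment⇒≤length : ∀ m {xs : List ℕ} → (∀ {j} → j < m → j ∈ₗ xs) → m ≤ length xs
initialSegment⇒≤length zero    below = z≤n
initialSegment⇒≤length (suc m) {xs} below = ≤-trans
  (s≤s (initialSegment⇒≤length m λ j<m →
    ∈-filter⁺ (λ x → ¬? (x ≟ m)) (below (m<n⇒m<1+n j<m)) (<⇒≢ j<m)))
  (filter-notAll (λ x → ¬? (x ≟ m)) xs (Any.map (λ m≡x x≢m → x≢m (sym m≡x)) (below ≤-refl)))

mexFrom-≡ : ∀ f k {m} {xs} → k ≤ m → m ≤ k + f →
            (∀ {j} → k ≤ j → j < m → j ∈ₗ xs) → m ∉ₗ xs → mexFrom (suc f) k xs ≡ m
mexFrom-≡ f k {m} {xs} k≤m m≤k+f present absent with k ∈ᵇ xs in k∈?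
... | false = ≤-antisym k≤m (≮⇒≥ λ k<m → subst T k∈? (from T-∈ᵇ⇔∈ (present ≤-refl k<m)))
... | true with m≤n⇒m<n∨m≡n k≤m
...   | inj₂ refl = contradiction (to T-∈ᵇ⇔∈ (subst T (sym k∈?) tt)) absent
mexFrom-≡ zero    k {m} _ m≤k+0 _ _ | true | inj₁ k<m =
  contradiction (≤-trans k<m (subst (m ≤_) (+-identityʳ k) m≤k+0)) (n≮n k)
mexFrom-≡ (suc f) k {m} _ m≤k+1+f present absent | true | inj₁ k<m =
  mexFrom-≡ f (suc k) k<m (subst (m ≤_) (+-suc k f) m≤k+1+f)
            (λ 1+k≤j → present (≤-trans (n≤1+n k) 1+k≤j)) absent

-- The fuel suc (length xs) of mex is enough by the pigeonhole bound.
mex-≡ : ∀ {m} {xs : List ℕ} → (∀ {j} → j < m → j ∈ₗ xs) → m ∉ₗ xs → mex xs ≡ m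
mex-≡ {m} {xs} present absent =
  mexFrom-≡ (length xs) 0 z≤n (initialSegment⇒≤length m present) (λ _ → present) absent

module _ {G : Graph n} {L : ℕ → Bool} {P : Subset n} where

  grundyF-≡ : ∀ f {m} →
              (∀ {j} → j < m → ∃[ U ] Move G L P U × grundyF f G L (P ─ U) ≡ j) →
              (∀ {U} → Move G L P U → grundyF f G L (P ─ U) ≢ m) →
              grundyF (suc f) G L P ≡ m
  grundyF-≡ f {m} present absent = mex-≡ realised (excluded ∘ ∈-map⁻ (grundyF f G L))
    where
    realised : ∀ {j} → j < m → j ∈ₗ map (grundyF f G L) (options G L P)
    realised j<m with present j<m
    ... | U , move , refl = ∈-map⁺ (grundyF f G L) (∈-options⁺ move)
    excluded : ¬ (∃[ Q ] Q ∈ₗ options G L P × m ≡ grundyF f G L Q)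
    excluded (Q , Q∈ , m≡) with ∈-options⁻ Q∈
    ... | U , move , refl = absent move (sym m≡)

module _ {G : Graph n} {L : ℕ → Bool} (L-positive : ∀ {k} → T (L k) → 1 ≤ k) where

  Move⇒∣rest∣<∣position∣ : ∀ {P U} → Move G L P U → ∣ P ─ U ∣ < ∣ P ∣
  Move⇒∣rest∣<∣position∣ {P} {U} move = subst (∣ P ─ U ∣ <_)
    (∣p─q∣+∣q∣≡∣p∣ {p = P} (removed⊆position move)) (m<m+n ∣ P ─ U ∣ (L-positive (size∈L move)))

  grundyF-empty : ∀ f {P} → ∣ P ∣ ≡ 0 → grundyF f G L P ≡ 0
  grundyF-empty zero    _     = refl
  grundyF-empty (suc f) {P} ∣P∣≡0 = grundyF-≡ f (λ ())
    λ {U} move → contradiction (subst (∣ P ─ U ∣ <_) ∣P∣≡0 (Move⇒∣rest∣<∣position∣ move)) λ ()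

  grundyF-singleton : ∀ f {P} → T (L 1) → ∣ P ∣ ≡ 1 → grundyF (suc f) G L P ≡ 1
  grundyF-singleton f {P} 1∈L ∣P∣≡1 = grundyF-≡ f removeAll
    λ {U} move → 0≢1+n ∘ trans (sym (grundyF-empty f
      (n<1⇒n≡0 (subst (∣ P ─ U ∣ <_) ∣P∣≡1 (Move⇒∣rest∣<∣position∣ move)))))
    where
    removeAll : ∀ {j} → j < 1 → ∃[ U ] Move G L P U × grundyF f G L (P ─ U) ≡ j
    removeAll (s≤s z≤n) = P , move , grundyF-empty f (∣p─p∣≡0 P)
      where
      move : Move G L P P
      move = record
        { removed⊆position = λ x∈P → x∈P
        ; size∈L           = subst (T ∘ L) (sym ∣P∣≡1) 1∈L
        ; removedConnected = ∣S∣≤1⇒connected G {P} (subst (_≤ 1) (sym ∣P∣≡1) ≤-refl)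
        ; restConnected    = ∣S∣≤1⇒connected G {P ─ P} (subst (_≤ 1) (sym (∣p─p∣≡0 P)) z≤n)
        }

-- The star S_{1^t} under I_N

T-I⁺ : ∀ {N k} → 1 ≤ k → k ≤ N → T (I N k)
T-I⁺ 1≤k k≤N = from T-∧ (≤⇒≤ᵇ 1≤k , ≤⇒≤ᵇ k≤N)

T-I⁻ : ∀ {N k} → T (I N k) → 1 ≤ k × k ≤ N
T-I⁻ {N} {k} k∈I with to T-∧ k∈I
... | 1≤ᵇk , k≤ᵇN = ≤ᵇ⇒≤ 1 k 1≤ᵇk , ≤ᵇ⇒≤ k N k≤ᵇN

I-positive : ∀ {N k} → T (I N k) → 1 ≤ k
I-positive = proj₁ ∘ T-I⁻

-- The Grundy value of the star with centre and K leaves: belowValue K while K < N,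
-- aboveValue i when K = N + i.
belowValue : ℕ → ℕ
belowValue zero                = 1
belowValue (suc zero)          = 2
belowValue (suc (suc zero))    = 3
belowValue (suc (suc (suc k))) = belowValue (suc k)

aboveValue : ℕ → ℕ
aboveValue zero          = 0
aboveValue (suc zero)    = 1
aboveValue (suc (suc i)) = aboveValue i

belowValue-suc≢ : ∀ k → belowValue (suc k) ≢ belowValue k
belowValue-suc≢ zero                = λ ()
belowValue-suc≢ (suc zero)          = λ ()
belowValue-suc≢ (suc (suc zero))    = λ ()
belowValue-suc≢ (suc (suc (suc k))) = belowValue-suc≢ (suc k)

2≤belowValue-suc : ∀ k → 2 ≤ belowValue (suc k)
2≤belowValue-suc zero                = ≤-refl
2≤belowValue-suc (suc zero)          = n≤1+n 2
2≤belowValue-suc (suc (suc zero))    = ≤-refl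
2≤belowValue-suc (suc (suc (suc k))) = 2≤belowValue-suc (suc k)

belowValue≢0 : ∀ k → belowValue k ≢ 0
belowValue≢0 zero    = λ ()
belowValue≢0 (suc k) = m<n⇒n≢0 (2≤belowValue-suc k)

<belowValue-suc : ∀ {j} k → j < belowValue (suc k) → j < 2 ⊎ (j ≡ 2 × belowValue k ≡ 2)
<belowValue-suc zero                j<2 = inj₁ j<2
<belowValue-suc (suc zero)          j<3 with m<1+n⇒m<n∨m≡n j<3
... | inj₁ j<2  = inj₁ j<2
... | inj₂ refl = inj₂ (refl , refl)
<belowValue-suc (suc (suc zero))    j<2 = inj₁ j<2
<belowValue-suc (suc (suc (suc k))) j<m = <belowValue-suc (suc k) j<m

aboveValue-suc≢ : ∀ i → aboveValue (suc i) ≢ aboveValue i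
aboveValue-suc≢ zero          = λ ()
aboveValue-suc≢ (suc zero)    = λ ()
aboveValue-suc≢ (suc (suc i)) = aboveValue-suc≢ i

<aboveValue-suc : ∀ {j} i → j < aboveValue (suc i) → j ≡ 0 × aboveValue i ≡ 0
<aboveValue-suc zero          (s≤s z≤n) = refl , refl
<aboveValue-suc (suc (suc i)) j<m       = <aboveValue-suc i j<m

2∤1 : ¬ 2 ∣ 1
2∤1 2∣1 with () ← ∣1⇒≡1 2∣1

2∣2+k⇒2∣k : ∀ {k} → 2 ∣ suc (suc k) → 2 ∣ k
2∣2+k⇒2∣k 2∣2+k = ∣m+n∣m⇒∣n 2∣2+k ∣-refl

2∣k⇒2∣2+k : ∀ {k} → 2 ∣ k → 2 ∣ suc (suc k)
2∣k⇒2∣2+k = ∣m∣n⇒∣m+n ∣-refl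

belowValue-odd : ∀ k → ¬ 2 ∣ k → belowValue k ≡ 2
belowValue-odd zero                2∤0 = contradiction (2 ∣0) 2∤0
belowValue-odd (suc zero)          _   = refl
belowValue-odd (suc (suc zero))    2∤2 = contradiction ∣-refl 2∤2
belowValue-odd (suc (suc (suc k))) 2∤k = belowValue-odd (suc k) (2∤k ∘ 2∣k⇒2∣2+k)

belowValue-even : ∀ k → 1 ≤ k → 2 ∣ k → belowValue k ≡ 3
belowValue-even (suc zero)          _ 2∣1 = contradiction 2∣1 2∤1
belowValue-even (suc (suc zero))    _ _   = refl
belowValue-even (suc (suc (suc k))) _ 2∣k = belowValue-even (suc k) (s≤s z≤n) (2∣2+k⇒2∣k 2∣k)

aboveValue-even : ∀ i → 2 ∣ i → aboveValue i ≡ 0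
aboveValue-even zero          _   = refl
aboveValue-even (suc zero)    2∣1 = contradiction 2∣1 2∤1
aboveValue-even (suc (suc i)) 2∣i = aboveValue-even i (2∣2+k⇒2∣k 2∣i)

aboveValue-odd : ∀ i → ¬ 2 ∣ i → aboveValue i ≡ 1
aboveValue-odd zero          2∤0 = contradiction (2 ∣0) 2∤0
aboveValue-odd (suc zero)    _   = refl
aboveValue-odd (suc (suc i)) 2∤i = aboveValue-odd i (2∤i ∘ 2∣k⇒2∣2+k)

module StarGame (t N : ℕ) (1≤N : 1 ≤ N) where

  StarMove : Subset (suc t) → Subset (suc t) → Set
  StarMove = Move (star t) (I N)

  value : ℕ → Subset (suc t) → ℕ
  value f = grundyF f (star t) (I N)

  value-clear : ∀ f {C} → ∣ C ∣ ≡ 0 → value f (outside ∷ C) ≡ 0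
  value-clear f {C} = grundyF-empty I-positive f {outside ∷ C}

  value-isolate : ∀ f {C} → ∣ C ∣ ≡ 1 → value (suc f) (outside ∷ C) ≡ 1
  value-isolate f {C} = grundyF-singleton I-positive f {outside ∷ C} (T-I⁺ ≤-refl 1≤N)

  pruneMove : ∀ {A ℓ} → ℓ ∈ A → StarMove (inside ∷ A) (outside ∷ ⁅ ℓ ⁆)
  pruneMove {A} {ℓ} ℓ∈A = record
    { removed⊆position = out⊆ (⁅x⁆⊆p ℓ∈A)
    ; size∈L           = subst (T ∘ I N) (sym (∣⁅x⁆∣≡1 ℓ)) (T-I⁺ ≤-refl 1≤N)
    ; removedConnected = ∣S∣≤1⇒connected (star t) {outside ∷ ⁅ ℓ ⁆}
                           (subst (_≤ 1) (sym (∣⁅x⁆∣≡1 ℓ)) ≤-refl)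
    ; restConnected    = star-connected-centre (A - ℓ)
    }

  clearMove : ∀ {A} → ∣ A ∣ < N → StarMove (inside ∷ A) (inside ∷ A)
  clearMove {A} ∣A∣<N = record
    { removed⊆position = λ x∈P → x∈P
    ; size∈L           = T-I⁺ (s≤s z≤n) ∣A∣<N
    ; removedConnected = star-connected-centre A
    ; restConnected    = ∣S∣≤1⇒connected (star t) {outside ∷ (A ─ A)}
                           (subst (_≤ 1) (sym (∣p─p∣≡0 A)) z≤n)
    }

  isolateMove : ∀ {A ℓ} → ℓ ∈ A → ∣ A ∣ ≤ N → StarMove (inside ∷ A) (inside ∷ (A - ℓ))
  isolateMove {A} {ℓ} ℓ∈A ∣A∣≤N = record
    { removed⊆position = s⊆s (p─q⊆p A ⁅ ℓ ⁆)
    ; size∈L           = T-I⁺ (s≤s z≤n) (subst (_≤ N) (sym (x∈p⇒1+∣p-x∣≡∣p∣ ℓ∈A)) ∣A∣≤N)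
    ; removedConnected = star-connected-centre (A - ℓ)
    ; restConnected    = ∣S∣≤1⇒connected (star t) {outside ∷ (A ─ (A - ℓ))}
                           (subst (_≤ 1) (sym (∣p─[p-x]∣≡1 ℓ∈A)) ≤-refl)
    }

  data CentreOption (K : ℕ) : Subset (suc t) → Set where
    prune   : ∀ {A} → suc ∣ A ∣ ≡ K → CentreOption K (inside ∷ A)
    clear   : ∀ {C} → ∣ C ∣ ≡ 0 → K < N → CentreOption K (outside ∷ C)
    isolate : ∀ {C} → ∣ C ∣ ≡ 1 → 1 ≤ K → K ≤ N → CentreOption K (outside ∷ C)

  -- A set of leaves is connected only if it has at most one element, so a move either
  -- prunes a single leaf or takes the centre and leaves at most one leaf behind.
  centreOption : ∀ {A U K} → ∣ A ∣ ≡ K → StarMove (inside ∷ A) U →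
                 CentreOption K ((inside ∷ A) ─ U)
  centreOption {A} {outside ∷ B} refl move = prune (begin
    suc ∣ A ─ B ∣      ≡⟨ +-comm 1 ∣ A ─ B ∣ ⟩
    ∣ A ─ B ∣ + 1      ≡⟨ cong (∣ A ─ B ∣ +_) (sym ∣B∣≡1) ⟩
    ∣ A ─ B ∣ + ∣ B ∣  ≡⟨ ∣p─q∣+∣q∣≡∣p∣ {p = A} (drop-∷-⊆ (removed⊆position move)) ⟩
    ∣ A ∣              ∎)
    where
    open ≡-Reasoning
    ∣B∣≡1 : ∣ B ∣ ≡ 1
    ∣B∣≡1 = ≤-antisym (star-connected-leaves⇒∣∣≤1 {C = B} (removedConnected move))
                      (T-I⁻ (size∈L move) .proj₁)
  centreOption {A} {inside ∷ B} refl move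
    with ∣ A ─ B ∣ in ∣rest∣ | ∣p─q∣+∣q∣≡∣p∣ {p = A} (drop-∷-⊆ (removed⊆position move))
       | star-connected-leaves⇒∣∣≤1 {C = A ─ B} (restConnected move)
  ... | 0 | ∣B∣≡∣A∣ | _ =
    clear ∣rest∣ (subst (λ k → suc k ≤ N) ∣B∣≡∣A∣ (T-I⁻ (size∈L move) .proj₂))
  ... | 1 | 1+∣B∣≡∣A∣ | _ =
    isolate ∣rest∣ (subst (1 ≤_) 1+∣B∣≡∣A∣ (s≤s z≤n))
                   (subst (_≤ N) 1+∣B∣≡∣A∣ (T-I⁻ (size∈L move) .proj₂))
  ... | suc (suc _) | _ | s≤s ()

  value-centre-below : ∀ f K {A} → ∣ A ∣ ≡ K → K < N → K < f → value f (inside ∷ A) ≡ belowValue K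
  value-centre-below (suc f) zero {A} ∣A∣≡0 0<N _ =
    grundyF-≡ f present (excluded ∘ centreOption ∣A∣≡0)
    where
    present : ∀ {j} → j < 1 → ∃[ U ] StarMove (inside ∷ A) U × value f ((inside ∷ A) ─ U) ≡ j
    present (s≤s z≤n) =
      inside ∷ A , clearMove (subst (_< N) (sym ∣A∣≡0) 0<N) , value-clear f (∣p─p∣≡0 A)
    excluded : ∀ {Q} → CentreOption 0 Q → value f Q ≢ 1
    excluded (clear ∣C∣≡0 _) = 0≢1+n ∘ trans (sym (value-clear f ∣C∣≡0))
  value-centre-below (suc (suc f)) (suc k) {A} ∣A∣≡1+k 1+k<N (s≤s k<1+f) =
    grundyF-≡ (suc f) present (excluded ∘ centreOption ∣A∣≡1+k)
    where
    ℓ = ∣p∣≡1+k⇒Nonempty ∣A∣≡1+k .proj₁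
    ℓ∈A = ∣p∣≡1+k⇒Nonempty ∣A∣≡1+k .proj₂
    ∣A-ℓ∣≡k : ∣ A - ℓ ∣ ≡ k
    ∣A-ℓ∣≡k = suc-injective (trans (x∈p⇒1+∣p-x∣≡∣p∣ ℓ∈A) ∣A∣≡1+k)
    ∣A∣<N : ∣ A ∣ < N
    ∣A∣<N = subst (_< N) (sym ∣A∣≡1+k) 1+k<N
    pruned : ∀ {A′} → ∣ A′ ∣ ≡ k → value (suc f) (inside ∷ A′) ≡ belowValue k
    pruned e = value-centre-below (suc f) k e (≤-trans (n≤1+n (suc k)) 1+k<N) k<1+f
    present : ∀ {j} → j < belowValue (suc k) →
              ∃[ U ] StarMove (inside ∷ A) U × value (suc f) ((inside ∷ A) ─ U) ≡ j
    present j<m with <belowValue-suc k j<m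
    ... | inj₁ (s≤s z≤n)       = inside ∷ A , clearMove ∣A∣<N , value-clear (suc f) (∣p─p∣≡0 A)
    ... | inj₁ (s≤s (s≤s z≤n)) =
      inside ∷ (A - ℓ) , isolateMove ℓ∈A (<⇒≤ ∣A∣<N) , value-isolate f (∣p─[p-x]∣≡1 ℓ∈A)
    ... | inj₂ (refl , bk≡2)   = outside ∷ ⁅ ℓ ⁆ , pruneMove ℓ∈A , trans (pruned ∣A-ℓ∣≡k) bk≡2
    excluded : ∀ {Q} → CentreOption (suc k) Q → value (suc f) Q ≢ belowValue (suc k)
    excluded (prune e)           v≡m =
      belowValue-suc≢ k (trans (sym v≡m) (pruned (suc-injective e)))
    excluded (clear ∣C∣≡0 _)     v≡m =
      m<n⇒n≢0 (2≤belowValue-suc k) (trans (sym v≡m) (value-clear (suc f) ∣C∣≡0))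
    excluded (isolate ∣C∣≡1 _ _) v≡m =
      <⇒≢ (2≤belowValue-suc k) (trans (sym (value-isolate f ∣C∣≡1)) v≡m)

  value-centre-above : ∀ f i {A} → ∣ A ∣ ≡ N + i → N + i < f → value f (inside ∷ A) ≡ aboveValue i
  value-centre-above (suc zero) zero _ (s≤s N+0≤0) =
    contradiction (≤-trans 1≤N (subst (_≤ 0) (+-identityʳ N) N+0≤0)) λ ()
  value-centre-above (suc (suc f)) zero {A} ∣A∣≡N+0 (s≤s N+0≤1+f) =
    grundyF-≡ (suc f) (λ ()) (excluded ∘ centreOption ∣A∣≡N+0)
    where
    excluded : ∀ {Q} → CentreOption (N + 0) Q → value (suc f) Q ≢ 0
    excluded (prune {A′} e) = belowValue≢0 ∣ A′ ∣ ∘ trans (sym (value-centre-below (suc f) ∣ A′ ∣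
      refl (subst (suc ∣ A′ ∣ ≤_) (trans e (+-identityʳ N)) ≤-refl) (subst (_≤ suc f) (sym e) N+0≤1+f)))
    excluded (clear _ N+0<N)     = contradiction N+0<N (m+n≮m N 0)
    excluded (isolate ∣C∣≡1 _ _) = 1+n≢0 ∘ trans (sym (value-isolate f ∣C∣≡1))
  value-centre-above (suc f) (suc i) {A} ∣A∣≡N+1+i (s≤s N+1+i≤f) =
    grundyF-≡ f present (excluded ∘ centreOption ∣A∣≡N+1+i)
    where
    ∣A∣≡1+N+i : ∣ A ∣ ≡ suc (N + i)
    ∣A∣≡1+N+i = trans ∣A∣≡N+1+i (+-suc N i)
    ℓ = ∣p∣≡1+k⇒Nonempty ∣A∣≡1+N+i .proj₁
    ℓ∈A = ∣p∣≡1+k⇒Nonempty ∣A∣≡1+N+i .proj₂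
    pruned : ∀ {A′} → suc ∣ A′ ∣ ≡ N + suc i → value f (inside ∷ A′) ≡ aboveValue i
    pruned e = value-centre-above f i (suc-injective (trans e (+-suc N i)))
                            (subst (_≤ f) (+-suc N i) N+1+i≤f)
    present : ∀ {j} → j < aboveValue (suc i) →
              ∃[ U ] StarMove (inside ∷ A) U × value f ((inside ∷ A) ─ U) ≡ j
    present j<m with <aboveValue-suc i j<m
    ... | refl , ai≡0 = outside ∷ ⁅ ℓ ⁆ , pruneMove ℓ∈A ,
                        trans (pruned (trans (x∈p⇒1+∣p-x∣≡∣p∣ ℓ∈A) ∣A∣≡N+1+i)) ai≡0
    excluded : ∀ {Q} → CentreOption (N + suc i) Q → value f Q ≢ aboveValue (suc i)
    excluded (prune e)         v≡m = aboveValue-suc≢ i (trans (sym v≡m) (pruned e))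
    excluded (clear _ K<N)         = contradiction K<N (m+n≮m N (suc i))
    excluded (isolate _ _ K≤N)     = contradiction K≤N (m+1+n≰m N)

m≤n∸1⇒m<n : ∀ {m n} → 1 ≤ n → m ≤ n ∸ 1 → m < n
m≤n∸1⇒m<n {n = suc n} _ m≤n = s≤s m≤n

lemma9 : (t N : ℕ) → 1 ≤ t → 3 ≤ N →
    ((t ≤ N ∸ 1 → ¬ (2 ∣ t) → 𝒢 (I N) (star t) ≡ 2)
    × (t ≤ N ∸ 1 → 2 ∣ t → 𝒢 (I N) (star t) ≡ 3)
    × (∀ i → t ≡ N + i → 2 ∣ i → 𝒢 (I N) (star t) ≡ 0)
    × (∀ i → t ≡ N + i → ¬ (2 ∣ i) → 𝒢 (I N) (star t) ≡ 1))
lemma9 t N 1≤t 3≤N =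
  (λ t≤N-1 2∤t → trans (star-below t≤N-1) (belowValue-odd t 2∤t)) ,
  (λ t≤N-1 2∣t → trans (star-below t≤N-1) (belowValue-even t 1≤t 2∣t)) ,
  (λ i t≡N+i 2∣i → trans (star-above i t≡N+i) (aboveValue-even i 2∣i)) ,
  (λ i t≡N+i 2∤i → trans (star-above i t≡N+i) (aboveValue-odd i 2∤i))
  where
  1≤N : 1 ≤ N
  1≤N = ≤-trans (s≤s z≤n) 3≤N
  open StarGame t N 1≤N
  t<2+t : t < suc (suc t)
  t<2+t = n≤1+n (suc t)
  star-below : t ≤ N ∸ 1 → 𝒢 (I N) (star t) ≡ belowValue t
  star-below t≤N-1 = value-centre-below (suc (suc t)) t (∣⊤∣≡n t) (m≤n∸1⇒m<n 1≤N t≤N-1) t<2+t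
  star-above : ∀ i → t ≡ N + i → 𝒢 (I N) (star t) ≡ aboveValue i
  star-above i t≡N+i = value-centre-above (suc (suc t)) i (trans (∣⊤∣≡n t) t≡N+i)
                                          (subst (_< suc (suc t)) t≡N+i t<2+t)
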